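{- Let $Q=(U,\Omega,r)$ be a non-degenerate multimatroid, let $A$ be a subtransversal of $\Omega$, and let $e\in A$ satisfy $r(\{e\})=1$. Then there is an independent set $I$ of $Q$ such that $e\in I$ and $Q|A=Q|I$.
   Context: A multimatroid $Q=(U,\Omega,r)$ consists of a finite set $U$, a partition $\Omega$ of $U$ into sets called skew classes (two distinct elements of the same skew class form a skew pair), and a function $r:\mathcal S(\Omega)\to\mathbb Z_{\ge 0}$ on the set $\mathcal S(\Omega)$ of subtransversals (sets meeting each skew class in at most one element; a transversal meets each skew class in exactly one element) satisfying: (1) $r(\emptyset)=0$; (2) $r(A)\le r(A\cup x)\le r(A)+1$ whenever $A\in\mathcal S(\Omega)$ and $x$ lies in a skew class avoiding $A$; (3) $r(A)+r(B)\ge r(A\cup B)+r(A\cap B)$ whenever $A\cup B\in\mathcal S(\Omega)$; (4) $r(A\cup x)-r(A)+r(A\cup y)-r(A)\ge 1$ whenever $A\in\mathcal S(\Omega)$ and $\{x,y\}$ is a skew pair in a skew class avoiding $A$. $Q$ is non-degenerate if no skew class has size $1$. A subtransversal $S$ is independent if $r(S)=|S|$. For $A\in\mathcal S(\Omega)$, the minor $Q|A$ is the multimatroid $(U',\Omega',r')$ where $\Omega'$ consists of the skew classes disjoint from $A$, $U'=\bigcup\Omega'$, and $r'(X)=r(X\cup A)-r(A)$ for subtransversals $X$ of $\Omega'$. Two multimatroids are equal if they have the same ground set, skew classes and rank function. -}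

module Defs where

open import Data.Nat using (ℕ; suc; _≤_; _+_; _∸_)
open import Data.Fin using (Fin)
open import Data.Fin.Subset using (Subset; ⊥; ⁅_⁆; _∈_; _⊆_; _∪_; _∩_; ∣_∣)
open import Data.Product using (Σ; ∃; _×_; _,_)
open import Relation.Binary.PropositionalEquality using (_≡_; _≢_)
open import Relation.Nullary using (¬_)

-- Ground set U = Fin n; the partition Ω into skew classes is given by a
-- surjective class map  cls : Fin n → Fin m  (blocks = fibres, all nonempty).
-- The rank function is a function on all subsets, but the axioms only
-- constrain it on subtransversals (only those values are meaningful).

IsSubtransversal : ∀ {n m} → (Fin n → Fin m) → Subset n → Set
IsSubtransversal cls S = ∀ x y → x ∈ S → y ∈ S → cls x ≡ cls y → x ≡ y

ClassAvoids : ∀ {n m} → (Fin n → Fin m) → Fin n → Subset n → Set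
ClassAvoids cls x A = ∀ y → y ∈ A → cls y ≢ cls x

record Multimatroid (n m : ℕ) : Set where
  field
    cls   : Fin n → Fin m
    cls-surjective : ∀ (c : Fin m) → ∃ λ x → cls x ≡ c
    r     : Subset n → ℕ
    r-empty : r ⊥ ≡ 0
    r-unit : ∀ A x → IsSubtransversal cls A → ClassAvoids cls x A →
             r A ≤ r (A ∪ ⁅ x ⁆) × r (A ∪ ⁅ x ⁆) ≤ suc (r A)
    r-submod : ∀ A B → IsSubtransversal cls (A ∪ B) →
               r (A ∪ B) + r (A ∩ B) ≤ r A + r B
    r-skew : ∀ A x y → IsSubtransversal cls A → x ≢ y → cls x ≡ cls y →
             ClassAvoids cls x A →
             1 ≤ (r (A ∪ ⁅ x ⁆) ∸ r A) + (r (A ∪ ⁅ y ⁆) ∸ r A)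

module _ {n m : ℕ} (Q : Multimatroid n m) where
  open Multimatroid Q

  Subtransversal : Subset n → Set
  Subtransversal = IsSubtransversal cls

  NonDegenerate : Set
  NonDegenerate = ∀ (c : Fin m) → Σ (Fin n) λ x → Σ (Fin n) λ y →
                    x ≢ y × cls x ≡ c × cls y ≡ c

  Independent : Subset n → Set
  Independent S = Subtransversal S × r S ≡ ∣ S ∣

  InMinorGround : Subset n → Fin n → Set
  InMinorGround A x = ClassAvoids cls x A

  minorRank : Subset n → Subset n → ℕ
  minorRank A X = r (X ∪ A) ∸ r A

  -- Q|A = Q|B : same ground set, same skew classes (both are the restriction
  -- of Ω to the common ground set), same rank function on subtransversals
  -- of Ω' (= subtransversals of Ω contained in U').
  MinorEq : Subset n → Subset n → Set
  MinorEq A B =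
    (∀ x → (InMinorGround A x → InMinorGround B x) × (InMinorGround B x → InMinorGround A x))
    × (∀ X → Subtransversal X → (∀ x → x ∈ X → InMinorGround A x) →
         minorRank A X ≡ minorRank B X)

-- Grow an independent set J inside the subtransversal T one element a of T ─ J
-- at a time. If r (J ∪ a) > r J, simply add a to J. Otherwise a is a loop over
-- J, hence (by submodularity) over every subtransversal containing J, so by
-- axiom (4) any skew partner y of a is a coloop over all of them; replacing a
-- by y in T then leaves the minor unchanged, and J ∪ y is independent. Each
-- step shrinks T ─ J, and once it is empty T = J is the required set.
module Submission where

open import Defs
open import Data.Nat using (ℕ; suc; _≤_; _+_; _∸_)
import Data.Nat.Properties as ℕ
open import Data.Fin as Fin using (Fin)
open import Data.Fin.Subset
  using (Subset; ⁅_⁆; _∈_; _∉_; ⊥; _∪_; _∩_; _─_; _-_; _⊆_; _⊂_; ∣_∣; inside; outside; Empty)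
open import Data.Fin.Subset.Properties
open import Data.Fin.Subset.Induction using (⊂-wellFounded)
open import Data.Product using (Σ; ∃; _×_; _,_; proj₁; proj₂)
open import Data.Sum using (inj₁; inj₂; [_,_]′)
open import Data.Vec.Base using (_∷_; here; there)
open import Function using (_∘_; id)
open import Induction.WellFounded using (Acc; acc)
open import Relation.Nullary using (¬_; Dec; yes; no; contradiction)
open import Relation.Binary.PropositionalEquality
  using (_≡_; _≢_; refl; sym; trans; cong; cong₂; subst; ≢-sym; module ≡-Reasoning)

x∈p─q⇒x∉q : ∀ {n} {x : Fin n} (p q : Subset n) → x ∈ p ─ q → x ∉ q
x∈p─q⇒x∉q (inside  ∷ p) (inside ∷ q) () here
x∈p─q⇒x∉q (outside ∷ p) (inside ∷ q) () here
x∈p─q⇒x∉q (_ ∷ p) (_ ∷ q) (there x∈p─q) (there x∈q) = x∈p─q⇒x∉q p q x∈p─q x∈q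

module _ {n : ℕ} where

  Empty[p─q]⇒p⊆q : ∀ {p q : Subset n} → Empty (p ─ q) → p ⊆ q
  Empty[p─q]⇒p⊆q {p} {q} empty {x} x∈p with x ∈? q
  ... | yes x∈q = x∈q
  ... | no  x∉q = contradiction (x , x∈p∧x∉q⇒x∈p─q x∈p x∉q) empty

  x∈p⇒⁅x⁆⊆p : ∀ {x : Fin n} {p} → x ∈ p → ⁅ x ⁆ ⊆ p
  x∈p⇒⁅x⁆⊆p {x} {p} x∈p y∈⁅x⁆ = subst (_∈ p) (sym (x∈⁅y⁆⇒x≡y x y∈⁅x⁆)) x∈p

  x∈p⇒p-x∪⁅x⁆≡p : ∀ {x : Fin n} {p} → x ∈ p → (p - x) ∪ ⁅ x ⁆ ≡ p
  x∈p⇒p-x∪⁅x⁆≡p {x} {p} x∈p = ⊆-antisym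
    ([ p─q⊆p p ⁅ x ⁆ , x∈p⇒⁅x⁆⊆p x∈p ]′ ∘ x∈p∪q⁻ (p - x) ⁅ x ⁆)
    (λ {y} y∈p → case-≟ y y∈p (y Fin.≟ x))
    where
    case-≟ : ∀ y → y ∈ p → Dec (y ≡ x) → y ∈ (p - x) ∪ ⁅ x ⁆
    case-≟ y _   (yes refl) = q⊆p∪q (p - x) ⁅ x ⁆ (x∈⁅x⁆ x)
    case-≟ y y∈p (no  y≢x)  = p⊆p∪q ⁅ x ⁆ (x∈p∧x≢y⇒x∈p-y y∈p y≢x)

  p⊆q⇒p∪r⊆q∪r : ∀ {p q : Subset n} r → p ⊆ q → p ∪ r ⊆ q ∪ r
  p⊆q⇒p∪r⊆q∪r {p} {q} r p⊆q = [ p⊆p∪q r ∘ p⊆q , q⊆p∪q q r ]′ ∘ x∈p∪q⁻ p r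

  q⊆p⇒p∪q≡p : ∀ {p q : Subset n} → q ⊆ p → p ∪ q ≡ p
  q⊆p⇒p∪q≡p {p} {q} q⊆p = ⊆-antisym ([ id , q⊆p ]′ ∘ x∈p∪q⁻ p q) (p⊆p∪q q)

  q⊆p⇒p∩q≡q : ∀ {p q : Subset n} → q ⊆ p → p ∩ q ≡ q
  q⊆p⇒p∩q≡q {p} {q} q⊆p = ⊆-antisym (p∩q⊆q p q) (λ x∈q → x∈p∩q⁺ (q⊆p x∈q , x∈q))

  p∪r─q∪r⊆p─q : ∀ {p q : Subset n} r → (p ∪ r) ─ (q ∪ r) ⊆ p ─ q
  p∪r─q∪r⊆p─q {p} {q} r {x} x∈ = x∈p∧x∉q⇒x∈p─q x∈p (x∉q∪r ∘ p⊆p∪q r)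
    where
    x∉q∪r : x ∉ q ∪ r
    x∉q∪r = x∈p─q⇒x∉q (p ∪ r) (q ∪ r) x∈
    x∈p : x ∈ p
    x∈p = [ id , (λ x∈r → contradiction (q⊆p∪q q r x∈r) x∉q∪r) ]′ (x∈p∪q⁻ p r (p─q⊆p (p ∪ r) (q ∪ r) x∈))

  x∉p⇒p∩⁅x⁆≡⊥ : ∀ {x : Fin n} {p} → x ∉ p → p ∩ ⁅ x ⁆ ≡ ⊥
  x∉p⇒p∩⁅x⁆≡⊥ {x} {p} x∉p = Empty-unique λ (y , y∈p∩⁅x⁆) →
    let y∈p , y∈⁅x⁆ = x∈p∩q⁻ p ⁅ x ⁆ y∈p∩⁅x⁆
    in x∉p (subst (_∈ p) (x∈⁅y⁆⇒x≡y x y∈⁅x⁆) y∈p)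

x∉p⇒∣p∪⁅x⁆∣≡1+∣p∣ : ∀ {n} (p : Subset n) x → x ∉ p → ∣ p ∪ ⁅ x ⁆ ∣ ≡ suc ∣ p ∣
x∉p⇒∣p∪⁅x⁆∣≡1+∣p∣ (outside ∷ p) Fin.zero    x∉p = cong suc (cong ∣_∣ (∪-identityʳ p))
x∉p⇒∣p∪⁅x⁆∣≡1+∣p∣ (inside  ∷ p) Fin.zero    x∉p = contradiction here x∉p
x∉p⇒∣p∪⁅x⁆∣≡1+∣p∣ (outside ∷ p) (Fin.suc x) x∉p = x∉p⇒∣p∪⁅x⁆∣≡1+∣p∣ p x (x∉p ∘ there)
x∉p⇒∣p∪⁅x⁆∣≡1+∣p∣ (inside  ∷ p) (Fin.suc x) x∉p = cong suc (x∉p⇒∣p∪⁅x⁆∣≡1+∣p∣ p x (x∉p ∘ there))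

module _ {n m : ℕ} (Q : Multimatroid n m) where
  open Multimatroid Q

  ClassAvoids-⊆ : ∀ {x A B} → A ⊆ B → ClassAvoids cls x B → ClassAvoids cls x A
  ClassAvoids-⊆ A⊆B avoids y y∈A = avoids y (A⊆B y∈A)

  ClassAvoids-∪ : ∀ {x A B} → ClassAvoids cls x A → ClassAvoids cls x B → ClassAvoids cls x (A ∪ B)
  ClassAvoids-∪ {A = A} {B} avoidsA avoidsB y y∈A∪B = [ avoidsA y , avoidsB y ]′ (x∈p∪q⁻ A B y∈A∪B)

  ClassAvoids-⁅⁆ : ∀ {x a} → cls a ≢ cls x → ClassAvoids cls x ⁅ a ⁆
  ClassAvoids-⁅⁆ {a = a} cls-a≢cls-x y y∈⁅a⁆ rewrite x∈⁅y⁆⇒x≡y a y∈⁅a⁆ = cls-a≢cls-x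

  ClassAvoids-skew : ∀ {x y A} → cls x ≡ cls y → ClassAvoids cls x A → ClassAvoids cls y A
  ClassAvoids-skew cls-x≡cls-y avoids z z∈A = avoids z z∈A ∘ (λ eq → trans eq (sym cls-x≡cls-y))

  ClassAvoids-∪⁅⁆-skew : ∀ {x a b S} → cls a ≡ cls b →
                         ClassAvoids cls x (S ∪ ⁅ a ⁆) → ClassAvoids cls x (S ∪ ⁅ b ⁆)
  ClassAvoids-∪⁅⁆-skew {x} {a} {b} {S} cls-a≡cls-b avoids = ClassAvoids-∪
    (ClassAvoids-⊆ (p⊆p∪q ⁅ a ⁆) avoids)
    (ClassAvoids-⁅⁆ (subst (_≢ cls x) cls-a≡cls-b (avoids a (q⊆p∪q S ⁅ a ⁆ (x∈⁅x⁆ a)))))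

  ClassAvoids⇒∉ : ∀ {x A} → ClassAvoids cls x A → x ∉ A
  ClassAvoids⇒∉ avoids x∈A = avoids _ x∈A refl

  Subtransversal-⊆ : ∀ {A B} → A ⊆ B → Subtransversal Q B → Subtransversal Q A
  Subtransversal-⊆ A⊆B stB x y x∈A y∈A = stB x y (A⊆B x∈A) (A⊆B y∈A)

  Subtransversal-⁅⁆ : ∀ a → Subtransversal Q ⁅ a ⁆
  Subtransversal-⁅⁆ a x y x∈⁅a⁆ y∈⁅a⁆ _ = trans (x∈⁅y⁆⇒x≡y a x∈⁅a⁆) (sym (x∈⁅y⁆⇒x≡y a y∈⁅a⁆))

  Subtransversal-∪ : ∀ {A B} → Subtransversal Q A → Subtransversal Q B →
                     (∀ x → x ∈ A → ClassAvoids cls x B) → Subtransversal Q (A ∪ B)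
  Subtransversal-∪ {A} {B} stA stB avoids x y x∈ y∈ cls-x≡cls-y
    with x∈p∪q⁻ A B x∈ | x∈p∪q⁻ A B y∈
  ... | inj₁ x∈A | inj₁ y∈A = stA x y x∈A y∈A cls-x≡cls-y
  ... | inj₁ x∈A | inj₂ y∈B = contradiction (sym cls-x≡cls-y) (avoids x x∈A y y∈B)
  ... | inj₂ x∈B | inj₁ y∈A = contradiction cls-x≡cls-y (avoids y y∈A x x∈B)
  ... | inj₂ x∈B | inj₂ y∈B = stB x y x∈B y∈B cls-x≡cls-y

  Subtransversal-∪⁅⁆ : ∀ {A a} → Subtransversal Q A → ClassAvoids cls a A → Subtransversal Q (A ∪ ⁅ a ⁆)
  Subtransversal-∪⁅⁆ {a = a} stA avoids = Subtransversal-∪ stA (Subtransversal-⁅⁆ a)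
    (λ x x∈A → ClassAvoids-⁅⁆ (≢-sym (avoids x x∈A)))

  Subtransversal⇒ClassAvoids : ∀ {T J a} → Subtransversal Q T → J ⊆ T → a ∈ T → a ∉ J →
                               ClassAvoids cls a J
  Subtransversal⇒ClassAvoids {J = J} stT J⊆T a∈T a∉J z z∈J cls-z≡cls-a =
    a∉J (subst (_∈ J) (stT _ _ (J⊆T z∈J) a∈T cls-z≡cls-a) z∈J)

  Independent-∪⁅⁆ : ∀ {J a} → Independent Q J → ClassAvoids cls a J →
                    r (J ∪ ⁅ a ⁆) ≡ suc (r J) → Independent Q (J ∪ ⁅ a ⁆)
  Independent-∪⁅⁆ {J} {a} (stJ , rJ≡∣J∣) avoids rank-suc =
    Subtransversal-∪⁅⁆ stJ avoids ,
    trans rank-suc (trans (cong suc rJ≡∣J∣) (sym (x∉p⇒∣p∪⁅x⁆∣≡1+∣p∣ J a (ClassAvoids⇒∉ avoids))))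

  Loop : Subset n → Fin n → Set
  Loop Z a = r (Z ∪ ⁅ a ⁆) ≡ r Z

  ¬Loop⇒rank-suc : ∀ {Z a} → Subtransversal Q Z → ClassAvoids cls a Z → ¬ Loop Z a →
                   r (Z ∪ ⁅ a ⁆) ≡ suc (r Z)
  ¬Loop⇒rank-suc {Z} {a} stZ avoids ¬loop =
    let lower , upper = r-unit Z a stZ avoids
    in ℕ.≤-antisym upper (ℕ.≤∧≢⇒< lower (≢-sym ¬loop))

  Loop-⊆ : ∀ {J Z a} → J ⊆ Z → Subtransversal Q Z → ClassAvoids cls a Z → Loop J a → Loop Z a
  Loop-⊆ {J} {Z} {a} J⊆Z stZ avoids loop =
    ℕ.≤-antisym (ℕ.+-cancelʳ-≤ (r J) _ _ submodular) (proj₁ (r-unit Z a stZ avoids))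
    where
    union : Z ∪ (J ∪ ⁅ a ⁆) ≡ Z ∪ ⁅ a ⁆
    union = trans (sym (∪-assoc Z J ⁅ a ⁆)) (cong (_∪ ⁅ a ⁆) (q⊆p⇒p∪q≡p J⊆Z))
    intersection : Z ∩ (J ∪ ⁅ a ⁆) ≡ J
    intersection = begin
      Z ∩ (J ∪ ⁅ a ⁆)        ≡⟨ ∩-distribˡ-∪ Z J ⁅ a ⁆ ⟩
      (Z ∩ J) ∪ (Z ∩ ⁅ a ⁆)  ≡⟨ cong₂ _∪_ (q⊆p⇒p∩q≡q J⊆Z) (x∉p⇒p∩⁅x⁆≡⊥ (ClassAvoids⇒∉ avoids)) ⟩
      J ∪ ⊥                  ≡⟨ ∪-identityʳ J ⟩
      J                      ∎
      where open ≡-Reasoning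
    submodular : r (Z ∪ ⁅ a ⁆) + r J ≤ r Z + r J
    submodular = begin
      r (Z ∪ ⁅ a ⁆) + r J                        ≡⟨ cong₂ _+_ (cong r union) (cong r intersection) ⟨
      r (Z ∪ (J ∪ ⁅ a ⁆)) + r (Z ∩ (J ∪ ⁅ a ⁆))  ≤⟨ r-submod Z (J ∪ ⁅ a ⁆) st ⟩
      r Z + r (J ∪ ⁅ a ⁆)                        ≡⟨ cong (r Z +_) loop ⟩
      r Z + r J                                  ∎
      where
      open ℕ.≤-Reasoning
      st : Subtransversal Q (Z ∪ (J ∪ ⁅ a ⁆))
      st = subst (Subtransversal Q) (sym union) (Subtransversal-∪⁅⁆ stZ avoids)

  Loop⇒skew-rank-suc : ∀ {Z a y} → Subtransversal Q Z → ClassAvoids cls a Z →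
                       y ≢ a → cls y ≡ cls a → Loop Z a → r (Z ∪ ⁅ y ⁆) ≡ suc (r Z)
  Loop⇒skew-rank-suc {Z} {a} {y} stZ avoids y≢a cls-y≡cls-a loop =
    ℕ.≤-antisym (proj₂ (r-unit Z y stZ avoids-y)) increase
    where
    avoids-y : ClassAvoids cls y Z
    avoids-y = ClassAvoids-skew (sym cls-y≡cls-a) avoids
    gap : 1 ≤ r (Z ∪ ⁅ y ⁆) ∸ r Z
    gap = subst (λ k → 1 ≤ k + (r (Z ∪ ⁅ y ⁆) ∸ r Z))
                (trans (cong (_∸ r Z) loop) (ℕ.n∸n≡0 (r Z)))
                (r-skew Z a y stZ (≢-sym y≢a) (sym cls-y≡cls-a) avoids)
    increase : suc (r Z) ≤ r (Z ∪ ⁅ y ⁆)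
    increase = begin-strict
      r Z                          <⟨ ℕ.m<m+n (r Z) gap ⟩
      r Z + (r (Z ∪ ⁅ y ⁆) ∸ r Z)  ≡⟨ ℕ.m+[n∸m]≡n (proj₁ (r-unit Z y stZ avoids-y)) ⟩
      r (Z ∪ ⁅ y ⁆)                ∎
      where open ℕ.≤-Reasoning

  MinorEq-refl : ∀ A → MinorEq Q A A
  MinorEq-refl A = (λ x → id , id) , (λ X _ _ → refl)

  MinorEq-trans : ∀ {A B C} → MinorEq Q A B → MinorEq Q B C → MinorEq Q A C
  MinorEq-trans (groundAB , rankAB) (groundBC , rankBC) =
    (λ x → let ab , ba = groundAB x ; bc , cb = groundBC x in bc ∘ ab , ba ∘ cb) ,
    (λ X stX X⊆U → trans (rankAB X stX X⊆U) (rankBC X stX (λ x x∈X → proj₁ (groundAB x) (X⊆U x x∈X))))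

  MinorEq-swap-loop : ∀ {J S a y} → J ⊆ S → Subtransversal Q S → ClassAvoids cls a S →
                      y ≢ a → cls y ≡ cls a → Loop J a → MinorEq Q (S ∪ ⁅ a ⁆) (S ∪ ⁅ y ⁆)
  MinorEq-swap-loop {J} {S} {a} {y} J⊆S stS avoids y≢a cls-y≡cls-a loop = ground , rank
    where
    ground : ∀ x → (InMinorGround Q (S ∪ ⁅ a ⁆) x → InMinorGround Q (S ∪ ⁅ y ⁆) x) ×
                   (InMinorGround Q (S ∪ ⁅ y ⁆) x → InMinorGround Q (S ∪ ⁅ a ⁆) x)
    ground x = ClassAvoids-∪⁅⁆-skew (sym cls-y≡cls-a) , ClassAvoids-∪⁅⁆-skew cls-y≡cls-a
    loop-over : ∀ {Z} → S ⊆ Z → Subtransversal Q Z → ClassAvoids cls a Z → Loop Z a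
    loop-over S⊆Z stZ avoidsZ = Loop-⊆ (S⊆Z ∘ J⊆S) stZ avoidsZ loop
    coloop-over : ∀ {Z} → S ⊆ Z → Subtransversal Q Z → ClassAvoids cls a Z → r (Z ∪ ⁅ y ⁆) ≡ suc (r Z)
    coloop-over S⊆Z stZ avoidsZ =
      Loop⇒skew-rank-suc stZ avoidsZ y≢a cls-y≡cls-a (loop-over S⊆Z stZ avoidsZ)
    rank : ∀ X → Subtransversal Q X → (∀ x → x ∈ X → InMinorGround Q (S ∪ ⁅ a ⁆) x) →
           minorRank Q (S ∪ ⁅ a ⁆) X ≡ minorRank Q (S ∪ ⁅ y ⁆) X
    rank X stX X⊆U = begin
      r (X ∪ (S ∪ ⁅ a ⁆)) ∸ r (S ∪ ⁅ a ⁆)  ≡⟨ cong₂ _∸_ (shift a (loop-over S⊆X∪S stXS avoidsXS))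
                                                      (loop-over id stS avoids) ⟩
      r (X ∪ S) ∸ r S                      ≡⟨⟩
      suc (r (X ∪ S)) ∸ suc (r S)          ≡⟨ cong₂ _∸_ (shift y (coloop-over S⊆X∪S stXS avoidsXS))
                                                      (coloop-over id stS avoids) ⟨
      r (X ∪ (S ∪ ⁅ y ⁆)) ∸ r (S ∪ ⁅ y ⁆)  ∎
      where
      open ≡-Reasoning
      S⊆X∪S : S ⊆ X ∪ S
      S⊆X∪S = q⊆p∪q X S
      stXS : Subtransversal Q (X ∪ S)
      stXS = Subtransversal-∪ stX stS (λ x x∈X → ClassAvoids-⊆ (p⊆p∪q ⁅ a ⁆) (X⊆U x x∈X))
      avoidsXS : ClassAvoids cls a (X ∪ S)
      avoidsXS = ClassAvoids-∪ (λ x x∈X → ≢-sym (X⊆U x x∈X a (q⊆p∪q S ⁅ a ⁆ (x∈⁅x⁆ a)))) avoids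
      shift : ∀ b {k} → r ((X ∪ S) ∪ ⁅ b ⁆) ≡ k → r (X ∪ (S ∪ ⁅ b ⁆)) ≡ k
      shift b = trans (cong r (sym (∪-assoc X S ⁅ b ⁆)))

  skew-partner : NonDegenerate Q → ∀ a → ∃ λ y → y ≢ a × cls y ≡ cls a
  skew-partner nonDeg a with nonDeg (cls a)
  ... | x , y , x≢y , cls-x≡cls-a , cls-y≡cls-a with x Fin.≟ a
  ...   | yes refl = y , ≢-sym x≢y , cls-y≡cls-a
  ...   | no  x≢a  = x , x≢a , cls-x≡cls-a

  Extendable : Subset n → Subset n → Set
  Extendable T J = Subtransversal Q T → J ⊆ T → Independent Q J →
                   ∃ λ I → Independent Q I × J ⊆ I × MinorEq Q T I

  extend-done : ∀ {T J} → Empty (T ─ J) → Extendable T J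
  extend-done {T} {J} empty _ J⊆T indJ = J , indJ , id , subst (λ X → MinorEq Q X J) J≡T (MinorEq-refl J)
    where
    J≡T : J ≡ T
    J≡T = ⊆-antisym J⊆T (Empty[p─q]⇒p⊆q empty)

  extend-coloop : ∀ {T J a} → a ∈ T ─ J → ¬ Loop J a →
                  (∀ {T′ J′} → T′ ─ J′ ⊆ (T ─ J) - a → Extendable T′ J′) → Extendable T J
  extend-coloop {T} {J} {a} a∈T─J ¬loop extend stT J⊆T indJ =
    let I , indI , J∪a⊆I , T≈I = extend shrinks stT J∪a⊆T indJ∪a
    in I , indI , J∪a⊆I ∘ p⊆p∪q ⁅ a ⁆ , T≈I
    where
    a∈T : a ∈ T
    a∈T = p─q⊆p T J a∈T─J
    avoids : ClassAvoids cls a J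
    avoids = Subtransversal⇒ClassAvoids stT J⊆T a∈T (x∈p─q⇒x∉q T J a∈T─J)
    indJ∪a : Independent Q (J ∪ ⁅ a ⁆)
    indJ∪a = Independent-∪⁅⁆ indJ avoids (¬Loop⇒rank-suc (proj₁ indJ) avoids ¬loop)
    J∪a⊆T : J ∪ ⁅ a ⁆ ⊆ T
    J∪a⊆T = [ J⊆T , x∈p⇒⁅x⁆⊆p a∈T ]′ ∘ x∈p∪q⁻ J ⁅ a ⁆
    shrinks : T ─ (J ∪ ⁅ a ⁆) ⊆ (T ─ J) - a
    shrinks = ⊆-reflexive (sym (p─q─r≡p─q∪r T J ⁅ a ⁆))

  extend-loop : ∀ {T J a} → NonDegenerate Q → a ∈ T ─ J → Loop J a →
                (∀ {T′ J′} → T′ ─ J′ ⊆ (T ─ J) - a → Extendable T′ J′) → Extendable T J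
  extend-loop {T} {J} {a} nonDeg a∈T─J loop extend stT J⊆T indJ
    with y , y≢a , cls-y≡cls-a ← skew-partner nonDeg a =
    let I , indI , J∪y⊆I , T′≈I = extend shrinks stT′ (p⊆q⇒p∪r⊆q∪r ⁅ y ⁆ J⊆S) indJ∪y
    in I , indI , J∪y⊆I ∘ p⊆p∪q ⁅ y ⁆ , MinorEq-trans T≈T′ T′≈I
    where
    S : Subset n
    S = T - a
    a∈T : a ∈ T
    a∈T = p─q⊆p T J a∈T─J
    J⊆S : J ⊆ S
    J⊆S z∈J = x∈p∧x≢y⇒x∈p-y (J⊆T z∈J) λ { refl → x∈p─q⇒x∉q T J a∈T─J z∈J }
    stS : Subtransversal Q S
    stS = Subtransversal-⊆ (p─q⊆p T ⁅ a ⁆) stT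
    avoidsS : ClassAvoids cls a S
    avoidsS = Subtransversal⇒ClassAvoids stT (p─q⊆p T ⁅ a ⁆) a∈T λ a∈S → x∈p─q⇒x∉q T ⁅ a ⁆ a∈S (x∈⁅x⁆ a)
    avoids-yS : ClassAvoids cls y S
    avoids-yS = ClassAvoids-skew (sym cls-y≡cls-a) avoidsS
    stT′ : Subtransversal Q (S ∪ ⁅ y ⁆)
    stT′ = Subtransversal-∪⁅⁆ stS avoids-yS
    indJ∪y : Independent Q (J ∪ ⁅ y ⁆)
    indJ∪y = Independent-∪⁅⁆ indJ (ClassAvoids-⊆ J⊆S avoids-yS)
      (Loop⇒skew-rank-suc (proj₁ indJ) (ClassAvoids-⊆ J⊆S avoidsS) y≢a cls-y≡cls-a loop)
    T≈T′ : MinorEq Q T (S ∪ ⁅ y ⁆)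
    T≈T′ = subst (λ X → MinorEq Q X (S ∪ ⁅ y ⁆)) (x∈p⇒p-x∪⁅x⁆≡p a∈T)
      (MinorEq-swap-loop J⊆S stS avoidsS y≢a cls-y≡cls-a loop)
    shrinks : (S ∪ ⁅ y ⁆) ─ (J ∪ ⁅ y ⁆) ⊆ (T ─ J) - a
    shrinks = ⊆-reflexive (p─q─r≡p─r─q T ⁅ a ⁆ J) ∘ p∪r─q∪r⊆p─q ⁅ y ⁆

  extend-step : ∀ {T J a} → NonDegenerate Q → a ∈ T ─ J →
                (∀ {T′ J′} → T′ ─ J′ ⊆ (T ─ J) - a → Extendable T′ J′) → Extendable T J
  extend-step {J = J} {a} nonDeg a∈T─J extend with r (J ∪ ⁅ a ⁆) ℕ.≟ r J
  ... | yes loop  = extend-loop nonDeg a∈T─J loop extend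
  ... | no  ¬loop = extend-coloop a∈T─J ¬loop extend

  extend-acc : NonDegenerate Q → ∀ {T J} → Acc _⊂_ (T ─ J) → Extendable T J
  extend-acc nonDeg {T} {J} (acc smaller) with nonempty? (T ─ J)
  ... | no  empty         = extend-done empty
  ... | yes (a , a∈T─J) = extend-step nonDeg a∈T─J λ T′─J′⊆ →
    extend-acc nonDeg (smaller (⊆-⊂-trans T′─J′⊆ (x∈p⇒p-x⊂p a∈T─J)))

  extend-independent : NonDegenerate Q → ∀ {T J} → Extendable T J
  extend-independent nonDeg = extend-acc nonDeg (⊂-wellFounded _)

theorem4 : ∀ {n m} (Q : Multimatroid n m) → NonDegenerate Q →
           ∀ (A : Subset n) → Subtransversal Q A →
           ∀ e → e ∈ A → Multimatroid.r Q ⁅ e ⁆ ≡ 1 →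
           Σ (Subset n) λ I → Independent Q I × e ∈ I × MinorEq Q A I
theorem4 Q nonDeg A stA e e∈A r⁅e⁆≡1 =
  let I , indI , ⁅e⁆⊆I , A≈I = extend-independent Q nonDeg stA (x∈p⇒⁅x⁆⊆p e∈A) ind⁅e⁆
  in I , indI , ⁅e⁆⊆I (x∈⁅x⁆ e) , A≈I
  where
  ind⁅e⁆ : Independent Q ⁅ e ⁆
  ind⁅e⁆ = Subtransversal-⁅⁆ Q e , trans r⁅e⁆≡1 (sym (∣⁅x⁆∣≡1 e))
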